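{- Let $G$ be a graph with a clique cutset $Q$, let $C$ be a component of $G\setminus Q$, and let $G'=G[C\cup Q]$ and $G''=G\setminus C$. If $P$ is a flat path in $G$, then each of $P\cap G'$ and $P\cap G''$ is either a path or empty.
   Context: A clique cutset of $G$ is a set $Q\subseteq V(G)$ that is a clique such that $G\setminus Q$ is disconnected. An induced path $(v_1,\dots,v_k)$ is flat if $v_2,\dots,v_{k-1}$ have degree $2$ in $G$. $P\cap G'$ denotes the subgraph of $P$ induced on $V(P)\cap V(G')$. -}

module Defs where

open import Data.Nat using (ℕ)
open import Data.Fin using (Fin)
open import Data.Fin.Subset using (Subset; _∈_; _∉_)
open import Data.List using (List; []; _∷_; length; filter; allFin)
open import Data.List.Membership.Propositional using () renaming (_∈_ to _∈ₗ_)
open import Data.List.Relation.Unary.Unique.Propositional using (Unique)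
open import Data.Product using (∃; _×_)
open import Data.Sum using (_⊎_)
open import Relation.Nullary using (¬_; Dec)
open import Relation.Binary.PropositionalEquality using (_≡_; _≢_)
open import Function.Bundles using (_⇔_)

record Graph : Set₁ where
  field
    n      : ℕ
    Adj    : Fin n → Fin n → Set
    adj?   : (x y : Fin n) → Dec (Adj x y)
    sym    : ∀ {x y} → Adj x y → Adj y x
    irrefl : ∀ {x} → ¬ Adj x x

open Graph public

degree : (G : Graph) → Fin (n G) → ℕ
degree G v = length (filter (adj? G v) (allFin (n G)))

data Link {A : Set} : List A → A → A → Set where
  here  : ∀ {x y t} → Link (x ∷ y ∷ t) x y
  there : ∀ {z x y t} → Link t x y → Link (z ∷ t) x y

Consec : {A : Set} → List A → A → A → Set
Consec w x y = Link w x y ⊎ Link w y x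

IsPathGraph : {m : ℕ} → (V : Fin m → Set) → (E : Fin m → Fin m → Set) → Set
IsPathGraph {m} V E =
  ∃ λ (w : List (Fin m)) →
    (w ≢ []) × Unique w × (∀ x → (x ∈ₗ w) ⇔ V x) ×
    (∀ x y → V x → V y → (E x y ⇔ Consec w x y))

IsInducedPath : (G : Graph) → List (Fin (n G)) → Set
IsInducedPath G w =
  (w ≢ []) × Unique w × (∀ x y → x ∈ₗ w → y ∈ₗ w → (Adj G x y ⇔ Consec w x y))

Interior : {A : Set} → List A → A → Set
Interior w x = ∃ λ a → ∃ λ b → Link w a x × Link w x b

IsFlatPath : (G : Graph) → List (Fin (n G)) → Set
IsFlatPath G w = IsInducedPath G w × (∀ x → Interior w x → degree G x ≡ 2)

IsClique : (G : Graph) → Subset (n G) → Set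
IsClique G Q = ∀ x y → x ∈ Q → y ∈ Q → x ≢ y → Adj G x y

data Reach (G : Graph) (S : Fin (n G) → Set) : Fin (n G) → Fin (n G) → Set where
  refl : ∀ {a} → S a → Reach G S a a
  step : ∀ {a b c} → S a → Adj G a b → Reach G S b c → Reach G S a c

Outside : (G : Graph) → Subset (n G) → Fin (n G) → Set
Outside G Q x = x ∉ Q

IsCliqueCutset : (G : Graph) → Subset (n G) → Set
IsCliqueCutset G Q =
  IsClique G Q ×
  (∃ λ a → ∃ λ b → a ∉ Q × b ∉ Q × ¬ Reach G (Outside G Q) a b)

IsComponentOfMinus : (G : Graph) → Subset (n G) → Subset (n G) → Set
IsComponentOfMinus G Q C =
  (∃ λ x → x ∈ C) ×
  (∀ x y → x ∈ C → (y ∈ C ⇔ Reach G (Outside G Q) x y))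

-- the subgraph of P induced on V(P) ∩ S (P an induced path of G, so its edges are
-- exactly the G-edges among its vertices) is a path or empty
PathOrEmpty : (G : Graph) → List (Fin (n G)) → (Fin (n G) → Set) → Set
PathOrEmpty G P S =
  IsPathGraph (λ x → x ∈ₗ P × S x) (Adj G)
  ⊎ (∀ x → ¬ (x ∈ₗ P × S x))

-- Both C ∪ Q and V ∖ C are vertex sets S whose edges to the rest of G all leave
-- from the clique Q. Restrict an induced path P to such an S. Two S-vertices
-- consecutive on P stay consecutive. Conversely, if x, y become consecutive only
-- after deleting the vertices between them, then x and y each have a neighbour
-- outside S on P, so both lie in Q and are adjacent; as P is induced they were
-- already consecutive on P, which is impossible with a vertex between them.
module Submission where

open import Defs
open import Data.Fin using (Fin)
open import Data.Fin.Subset using (Subset; _∈_; _∉_; _∪_)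
open import Data.Fin.Subset.Properties using (_∈?_; x∈p∪q⁻; x∈p∪q⁺)
open import Data.List using (List; []; _∷_; filter)
open import Data.List.Membership.Propositional using () renaming (_∈_ to _∈ₗ_; _∉_ to _∉ₗ_)
open import Data.List.Properties using (filter-accept)
open import Data.List.Membership.Propositional.Properties using (∉[]; ∈-filter⁺; ∈-filter⁻)
open import Data.List.Relation.Unary.Any using (here; there)
open import Data.List.Relation.Unary.AllPairs using (_∷_; tail)
open import Data.List.Relation.Unary.Unique.Propositional using (Unique)
open import Data.List.Relation.Unary.Unique.Propositional.Properties
  using (filter⁺; Unique[x∷xs]⇒x∉xs)
open import Data.Product using (_×_; _,_; proj₁; proj₂; ∃)
open import Data.Sum using (_⊎_; inj₁; inj₂)
open import Relation.Nullary using (¬_; yes; no; contradiction)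
open import Relation.Nullary.Decidable using (¬?)
open import Relation.Unary using (Decidable)
open import Relation.Binary.PropositionalEquality using (_≡_; _≢_; refl; trans; subst) renaming (sym to ≡-sym)
open import Function.Bundles using (mk⇔; Equivalence)

module _ {A : Set} where

  Link⇒∈ˡ : ∀ {t : List A} {x y} → Link t x y → x ∈ₗ t
  Link⇒∈ˡ here      = here refl
  Link⇒∈ˡ (there l) = there (Link⇒∈ˡ l)

  Link⇒∈ʳ : ∀ {t : List A} {x y} → Link t x y → y ∈ₗ t
  Link⇒∈ʳ here      = there (here refl)
  Link⇒∈ʳ (there l) = there (Link⇒∈ʳ l)

  Link-∷⁻ : ∀ {a : A} {t x y} → Link (a ∷ t) x y →
            (x ≡ a × ∃ λ r → t ≡ y ∷ r) ⊎ Link t x y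
  Link-∷⁻ here      = inj₁ (refl , _ , refl)
  Link-∷⁻ (there l) = inj₂ l

  Consec-there : ∀ {a : A} {t x y} → Consec t x y → Consec (a ∷ t) x y
  Consec-there (inj₁ l) = inj₁ (there l)
  Consec-there (inj₂ l) = inj₂ (there l)

  Consec-tail : ∀ {a : A} {t x y} → a ∉ₗ t → x ∈ₗ t → y ∈ₗ t →
                Consec (a ∷ t) x y → Consec t x y
  Consec-tail a∉t x∈t y∈t (inj₁ here)      = contradiction x∈t a∉t
  Consec-tail a∉t x∈t y∈t (inj₁ (there l)) = inj₁ l
  Consec-tail a∉t x∈t y∈t (inj₂ here)      = contradiction y∈t a∉t
  Consec-tail a∉t x∈t y∈t (inj₂ (there l)) = inj₂ l

  ¬Consec-skip : ∀ {x b y : A} {t} → Unique (x ∷ b ∷ t) → y ∈ₗ t →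
                 ¬ Consec (x ∷ b ∷ t) x y
  ¬Consec-skip (_ ∷ b∷t-unique) y∈t (inj₁ here) =
    Unique[x∷xs]⇒x∉xs b∷t-unique y∈t
  ¬Consec-skip u y∈t (inj₁ (there l)) = Unique[x∷xs]⇒x∉xs u (Link⇒∈ˡ l)
  ¬Consec-skip u y∈t (inj₂ here)      = Unique[x∷xs]⇒x∉xs u (there y∈t)
  ¬Consec-skip u y∈t (inj₂ (there l)) = Unique[x∷xs]⇒x∉xs u (Link⇒∈ʳ l)

module _ {A : Set} {S : A → Set} (S? : Decidable S) where

  Link-filter⁺ : ∀ {t x y} → S x → S y → Link t x y → Link (filter S? t) x y
  Link-filter⁺ {x ∷ y ∷ t} sx sy here
    rewrite filter-accept S? {x} {y ∷ t} sx | filter-accept S? {y} {t} sy = here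
  Link-filter⁺ {z ∷ t} sx sy (there l) with S? z
  ... | yes _ = there (Link-filter⁺ sx sy l)
  ... | no _  = Link-filter⁺ sx sy l

  Consec-filter⁺ : ∀ {t x y} → S x → S y → Consec t x y → Consec (filter S? t) x y
  Consec-filter⁺ sx sy (inj₁ l) = inj₁ (Link-filter⁺ sx sy l)
  Consec-filter⁺ sx sy (inj₂ l) = inj₂ (Link-filter⁺ sy sx l)

  module _ (B : A → Set) where

    ConsecutiveOn : List A → Set
    ConsecutiveOn t = ∀ x y → x ∈ₗ t → y ∈ₗ t → B x → B y → x ≢ y → Consec t x y

    ListBoundaryIn : List A → Set
    ListBoundaryIn t = ∀ x y → S x → ¬ S y → Consec t x y → B x

    ConsecutiveOn-tail : ∀ {a t} → Unique (a ∷ t) → ConsecutiveOn (a ∷ t) → ConsecutiveOn t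
    ConsecutiveOn-tail u consec x y x∈t y∈t bx by x≢y =
      Consec-tail (Unique[x∷xs]⇒x∉xs u) x∈t y∈t (consec x y (there x∈t) (there y∈t) bx by x≢y)

    ListBoundaryIn-tail : ∀ {a t} → ListBoundaryIn (a ∷ t) → ListBoundaryIn t
    ListBoundaryIn-tail bnd x y sx ¬sy c = bnd x y sx ¬sy (Consec-there c)

    head-filter∈B : ∀ {u t y r} → ¬ S u → filter S? t ≡ y ∷ r →
                    ListBoundaryIn (u ∷ t) → B y
    head-filter∈B {t = []} ¬su () bnd
    head-filter∈B {u} {c ∷ t} {y} ¬su eq bnd with S? c
    ... | no ¬sc = head-filter∈B ¬sc eq (ListBoundaryIn-tail bnd)
    ... | yes sc with eq
    ...   | refl = bnd y u sc ¬su (inj₂ here)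

    -- If the element b after x is outside S, then x and the next S-element y both lie
    -- in B, so they would be consecutive although b separates them.
    Link-head-filter : ∀ {x t y r} → S x → Unique (x ∷ t) → ConsecutiveOn (x ∷ t) →
                       ListBoundaryIn (x ∷ t) → filter S? t ≡ y ∷ r → Link (x ∷ t) x y
    Link-head-filter {t = []} sx u consec bnd ()
    Link-head-filter {x} {b ∷ t} {y} sx u consec bnd eq with S? b
    ... | yes _ with eq
    ...   | refl = here
    Link-head-filter {x} {b ∷ t} {y} sx u consec bnd eq | no ¬sb =
      contradiction (consec x y (here refl) (there (there y∈t)) bx by x≢y)
                    (¬Consec-skip u y∈t)
      where
      y∈t : y ∈ₗ t
      y∈t = proj₁ (∈-filter⁻ S? {xs = t} (subst (y ∈ₗ_) (≡-sym eq) (here refl)))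
      bx : B x
      bx = bnd x b sx ¬sb (inj₁ here)
      by : B y
      by = head-filter∈B ¬sb eq (ListBoundaryIn-tail bnd)
      x≢y : x ≢ y
      x≢y refl = Unique[x∷xs]⇒x∉xs u (there y∈t)

    Link-filter⁻ : ∀ {t x y} → Unique t → ConsecutiveOn t → ListBoundaryIn t →
                   Link (filter S? t) x y → Link t x y
    Link-filter⁻ {a ∷ t} u consec bnd l with S? a
    ... | no _ =
      there (Link-filter⁻ (tail u) (ConsecutiveOn-tail u consec) (ListBoundaryIn-tail bnd) l)
    ... | yes sa with Link-∷⁻ l
    ...   | inj₁ (refl , _ , eq) = Link-head-filter sa u consec bnd eq
    ...   | inj₂ l′ =
      there (Link-filter⁻ (tail u) (ConsecutiveOn-tail u consec) (ListBoundaryIn-tail bnd) l′)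

    Consec-filter⁻ : ∀ {t x y} → Unique t → ConsecutiveOn t → ListBoundaryIn t →
                     Consec (filter S? t) x y → Consec t x y
    Consec-filter⁻ u consec bnd (inj₁ l) = inj₁ (Link-filter⁻ u consec bnd l)
    Consec-filter⁻ u consec bnd (inj₂ l) = inj₂ (Link-filter⁻ u consec bnd l)

BoundaryIn : (G : Graph) → (Fin (n G) → Set) → Subset (n G) → Set
BoundaryIn G S Q = ∀ x y → S x → ¬ S y → Adj G x y → x ∈ Q

IsInducedPath⇒PathOrEmpty : ∀ G {P S} (S? : Decidable S) {Q} → IsInducedPath G P →
                            IsClique G Q → BoundaryIn G S Q → PathOrEmpty G P S
IsInducedPath⇒PathOrEmpty G {P} S? {Q} (_ , u , induced) clique boundary
  with filter S? P in eq
... | [] = inj₂ λ x (x∈P , sx) → ∉[] (subst (x ∈ₗ_) eq (∈-filter⁺ S? x∈P sx))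
... | _ ∷ _ = inj₁
  ( filter S? P
  , (λ filter≡[] → contradiction (trans (≡-sym eq) filter≡[]) λ ())
  , filter⁺ S? u
  , (λ x → mk⇔ (∈-filter⁻ S?) (λ (x∈P , sx) → ∈-filter⁺ S? x∈P sx))
  , λ x y (x∈P , sx) (y∈P , sy) → mk⇔
      (λ xy → Consec-filter⁺ S? sx sy (Equivalence.to (induced x y x∈P y∈P) xy))
      (λ c → Equivalence.from (induced x y x∈P y∈P)
               (Consec-filter⁻ S? (_∈ Q) u consecutive list-boundary c)))
  where
  consecutive : ConsecutiveOn S? (_∈ Q) P
  consecutive x y x∈P y∈P x∈Q y∈Q x≢y =
    Equivalence.to (induced x y x∈P y∈P) (clique x y x∈Q y∈Q x≢y)
  list-boundary : ListBoundaryIn S? (_∈ Q) P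
  list-boundary x y sx ¬sy (inj₁ l) =
    boundary x y sx ¬sy (Equivalence.from (induced x y (Link⇒∈ˡ l) (Link⇒∈ʳ l)) (inj₁ l))
  list-boundary x y sx ¬sy (inj₂ l) =
    boundary x y sx ¬sy (Equivalence.from (induced x y (Link⇒∈ʳ l) (Link⇒∈ˡ l)) (inj₂ l))

module _ {G : Graph} {Q C : Subset (n G)} (component : IsComponentOfMinus G Q C) where

  ∈C⇒∉Q : ∀ {x} → x ∈ C → x ∉ Q
  ∈C⇒∉Q {x} x∈C with Equivalence.to (proj₂ component x x x∈C) x∈C
  ... | refl x∉Q     = x∉Q
  ... | step x∉Q _ _ = x∉Q

  ∈C-adjacent : ∀ {x y} → x ∈ C → Adj G x y → y ∉ Q → y ∈ C
  ∈C-adjacent {x} {y} x∈C xy y∉Q =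
    Equivalence.from (proj₂ component x y x∈C) (step (∈C⇒∉Q x∈C) xy (refl y∉Q))

  BoundaryIn-C∪Q : BoundaryIn G (λ x → x ∈ (C ∪ Q)) Q
  BoundaryIn-C∪Q x y x∈C∪Q y∉C∪Q xy with x∈p∪q⁻ C Q x∈C∪Q
  ... | inj₂ x∈Q = x∈Q
  ... | inj₁ x∈C = contradiction (x∈p∪q⁺ (inj₁ (∈C-adjacent x∈C xy y∉Q))) y∉C∪Q
    where
    y∉Q : y ∉ Q
    y∉Q y∈Q = y∉C∪Q (x∈p∪q⁺ (inj₂ y∈Q))

  BoundaryIn-∉C : BoundaryIn G (λ x → x ∉ C) Q
  BoundaryIn-∉C x y x∉C ¬y∉C xy with x ∈? Q | y ∈? C
  ... | yes x∈Q | _      = x∈Q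
  ... | no x∉Q | yes y∈C = contradiction (∈C-adjacent y∈C (Graph.sym G xy) x∉Q) x∉C
  ... | no _   | no y∉C  = contradiction y∉C ¬y∉C

lemma4p1 : (G : Graph) → (Q C : Subset (n G)) →
    IsCliqueCutset G Q → IsComponentOfMinus G Q C →
    (P : List (Fin (n G))) → IsFlatPath G P →
    PathOrEmpty G P (λ x → x ∈ (C ∪ Q)) × PathOrEmpty G P (λ x → x ∉ C)
lemma4p1 G Q C (clique , _) component P (induced , _) =
    IsInducedPath⇒PathOrEmpty G (λ x → x ∈? (C ∪ Q)) induced clique (BoundaryIn-C∪Q component)
  , IsInducedPath⇒PathOrEmpty G (λ x → ¬? (x ∈? C)) induced clique (BoundaryIn-∉C component)
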